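{- Let $(P,\leq)$ be a poset, $f \in \operatorname{Aut}(P)$, and $x,y,c \in P$ with $f(c) = c$ and $x < c < y$. Then $\mathcal{O}_f(x) <_f^s \mathcal{O}_f(y)$.
   Context: For $f\in\operatorname{Aut}(P)$: $x\sim_f y$ iff $f^i(x)\le y\le f^j(x)$ for some $i,j\in\mathbb{Z}$, with class $\mathcal{O}_f(x)$. $\mathcal{O}_f(x) <_f^s \mathcal{O}_f(y)$ iff $x'<y'$ for all $x'\sim_f x$ and all $y'\sim_f y$. -}

module Defs where

open import Level using (Level)
open import Data.Nat using (ℕ; zero; suc)
open import Data.Integer using (ℤ; +_; -[1+_])
open import Data.Product using (_×_; ∃₂)
open import Relation.Binary.Bundles using (Poset)
import Relation.Binary.Construct.NonStrictToStrict as NSS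

module _ {c ℓ₁ ℓ₂ : Level} (P : Poset c ℓ₁ ℓ₂) where
  open Poset P

  _<ₚ_ : Carrier → Carrier → Set _
  _<ₚ_ = NSS._<_ _≈_ _≤_

  record Aut : Set (c Level.⊔ ℓ₁ Level.⊔ ℓ₂) where
    field
      fun     : Carrier → Carrier
      inv     : Carrier → Carrier
      fun-mono : ∀ {x y} → x ≤ y → fun x ≤ fun y
      inv-mono : ∀ {x y} → x ≤ y → inv x ≤ inv y
      inv-fun  : ∀ x → inv (fun x) ≈ x
      fun-inv  : ∀ x → fun (inv x) ≈ x

  iterℕ : (Carrier → Carrier) → ℕ → Carrier → Carrier
  iterℕ h zero    x = x
  iterℕ h (suc n) x = h (iterℕ h n x)

  _^[_] : Aut → ℤ → Carrier → Carrier
  f ^[ + n ]     = iterℕ (Aut.fun f) n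
  f ^[ -[1+ n ] ] = iterℕ (Aut.inv f) (suc n)

  _∼[_]_ : Carrier → Aut → Carrier → Set _
  x ∼[ f ] y = ∃₂ λ (i j : ℤ) → ((f ^[ i ]) x ≤ y) × (y ≤ (f ^[ j ]) x)

  -- O_f(x) <ˢ_f O_f(y)  iff  x' < y' for all x' ∈ O_f(x), y' ∈ O_f(y)  (O_f(x) = {x' | x ∼_f x'})
  OrbStrictLt : Aut → Carrier → Carrier → Set _
  OrbStrictLt f x y = ∀ x' y' → x ∼[ f ] x' → y ∼[ f ] y' → x' <ₚ y'

-- Automorphisms preserve the strict order and every iterate fixes c, so for
-- x' ∼ x and y' ∼ y we get x' ≤ fʲ x < fʲ c ≈ c ≈ fⁱ c < fⁱ y ≤ y'.
module Submission where

open import Defs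
open import Level using (Level; _⊔_)
open import Relation.Binary.Bundles using (Poset)
open import Data.Nat using (zero; suc)
open import Data.Integer using (+_; -[1+_])
open import Data.Product using (_,_; proj₁)
import Relation.Binary.Construct.NonStrictToStrict as NSS
import Relation.Binary.Properties.Poset as PosetProperties

module _ {a ℓ₁ ℓ₂ : Level} (P : Poset a ℓ₁ ℓ₂) where
  open Poset P
  open PosetProperties P using (mono⇒cong)

  Monotone : (Carrier → Carrier) → Set (a ⊔ ℓ₂)
  Monotone h = ∀ {u v} → u ≤ v → h u ≤ h v

  record IsOrderEmbedding (h : Carrier → Carrier) : Set (a ⊔ ℓ₁ ⊔ ℓ₂) where
    field
      mono      : Monotone h
      injective : ∀ {u v} → h u ≈ h v → u ≈ v

  id-isOrderEmbedding : IsOrderEmbedding (λ u → u)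
  id-isOrderEmbedding = record { mono = λ u≤v → u≤v ; injective = λ e → e }

  ∘-isOrderEmbedding : ∀ {g h} → IsOrderEmbedding g → IsOrderEmbedding h →
                       IsOrderEmbedding (λ u → g (h u))
  ∘-isOrderEmbedding g h = record
    { mono      = λ u≤v → IsOrderEmbedding.mono g (IsOrderEmbedding.mono h u≤v)
    ; injective = λ e → IsOrderEmbedding.injective h (IsOrderEmbedding.injective g e)
    }

  iterℕ-isOrderEmbedding : ∀ {h} → IsOrderEmbedding h → ∀ n → IsOrderEmbedding (iterℕ P h n)
  iterℕ-isOrderEmbedding h zero    = id-isOrderEmbedding
  iterℕ-isOrderEmbedding h (suc n) = ∘-isOrderEmbedding h (iterℕ-isOrderEmbedding h n)

  isOrderEmbedding⇒<-mono : ∀ {h} → IsOrderEmbedding h →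
                            ∀ {u v} → _<ₚ_ P u v → _<ₚ_ P (h u) (h v)
  isOrderEmbedding⇒<-mono h (u≤v , u≉v) =
    IsOrderEmbedding.mono h u≤v , λ e → u≉v (IsOrderEmbedding.injective h e)

  iterℕ-fixes : ∀ {h c} → Monotone h → h c ≈ c → ∀ n → iterℕ P h n c ≈ c
  iterℕ-fixes h-mono hc≈c zero    = Eq.refl
  iterℕ-fixes h-mono hc≈c (suc n) = Eq.trans (mono⇒cong h-mono (iterℕ-fixes h-mono hc≈c n)) hc≈c

  ≤-<ₚ-trans : ∀ {u v w} → u ≤ v → _<ₚ_ P v w → _<ₚ_ P u w
  ≤-<ₚ-trans = NSS.≤-<-trans _≈_ _≤_ trans antisym ≤-respˡ-≈

  <ₚ-≤-trans : ∀ {u v w} → _<ₚ_ P u v → v ≤ w → _<ₚ_ P u w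
  <ₚ-≤-trans = NSS.<-≤-trans _≈_ _≤_ Eq.sym trans antisym ≤-respʳ-≈

  module _ (f : Aut P) where
    open Aut f

    fun-isOrderEmbedding : IsOrderEmbedding fun
    fun-isOrderEmbedding = record
      { mono      = fun-mono
      ; injective = λ {u} {v} e →
          Eq.trans (Eq.sym (inv-fun u)) (Eq.trans (mono⇒cong inv-mono e) (inv-fun v))
      }

    inv-isOrderEmbedding : IsOrderEmbedding inv
    inv-isOrderEmbedding = record
      { mono      = inv-mono
      ; injective = λ {u} {v} e →
          Eq.trans (Eq.sym (fun-inv u)) (Eq.trans (mono⇒cong fun-mono e) (fun-inv v))
      }

    ^-isOrderEmbedding : ∀ k → IsOrderEmbedding (_^[_] P f k)
    ^-isOrderEmbedding (+ n)    = iterℕ-isOrderEmbedding fun-isOrderEmbedding n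
    ^-isOrderEmbedding -[1+ n ] = iterℕ-isOrderEmbedding inv-isOrderEmbedding (suc n)

    ^-<ₚ-mono : ∀ k {u v} → _<ₚ_ P u v → _<ₚ_ P ((_^[_] P f k) u) ((_^[_] P f k) v)
    ^-<ₚ-mono k = isOrderEmbedding⇒<-mono (^-isOrderEmbedding k)

    inv-fixes : ∀ {c} → fun c ≈ c → inv c ≈ c
    inv-fixes {c} fc≈c = Eq.trans (Eq.sym (mono⇒cong inv-mono fc≈c)) (inv-fun c)

    ^-fixes : ∀ {c} → fun c ≈ c → ∀ k → (_^[_] P f k) c ≈ c
    ^-fixes fc≈c (+ n)    = iterℕ-fixes fun-mono fc≈c n
    ^-fixes fc≈c -[1+ n ] = iterℕ-fixes inv-mono (inv-fixes fc≈c) (suc n)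

mainTheorem16 : {a ℓ₁ ℓ₂ : Level} (P : Poset a ℓ₁ ℓ₂) (f : Aut P)
    (x y c : Poset.Carrier P) →
    Poset._≈_ P (Aut.fun f c) c →
    _<ₚ_ P x c → _<ₚ_ P c y →
    OrbStrictLt P f x y
mainTheorem16 P f x y c fc≈c x<c c<y x' y' (_ , j , _ , x'≤fʲx) (i , _ , fⁱy≤y' , _) =
  ≤-<ₚ-trans P x'≤fʲx (<ₚ-≤-trans P fʲx<c c≤y')
  where
    open Poset P
    fʲx<c : _<ₚ_ P ((_^[_] P f j) x) c
    fʲx<c = <ₚ-≤-trans P (^-<ₚ-mono P f j x<c) (reflexive (^-fixes P f fc≈c j))
    c≤y' : c ≤ y'
    c≤y' = trans (reflexive (Eq.sym (^-fixes P f fc≈c i)))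
                 (trans (IsOrderEmbedding.mono (^-isOrderEmbedding P f i) (proj₁ c<y)) fⁱy≤y')
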